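{- Let $U$ be a non-empty finite set of positive integers, $p=(p_1,p_2)$ with $p_1,p_2$ positive integers and $p_1+p_2=|U|$, $p'=(p_2,p_1)$, and let $H$ be a finite graph (loops and parallel edges allowed) with $U\subseteq V(H)$. Let $E_0\subseteq E(H)$ be such that the spanning subgraph $H\langle E_0\rangle$ is acyclic. Then (i) for every $T\in\mathcal{T}_{U,p}(E_0)$, the dual $T^*$ is a tree in $\mathcal{T}_{U,p'}(E_0)$; and (ii) $T\mapsto T^*$ is a bijection from $\mathcal{T}_{U,p}(E_0)$ to $\mathcal{T}_{U,p'}(E_0)$.
   Context: A tiered graph with two tiers is a simple graph $G$ whose vertex set is a finite set of positive integers, together with a map $t:V(G)\to\{1,2\}$ such that whenever $vv'\in E(G)$ with $v>v'$ we have $t(v)>t(v')$; write $V_i(G)=t^{ -1}(i)$. $\mathcal{F}_{U,p}$ is the set of tiered forests $F$ with $V(F)=U$ and $|V_i(F)|=p_i$. Dual of a tiered graph: for a connected tiered graph $C$ with $V(C)=\{x_1<\cdots<x_s\}$ and tiering map $t$, its dual $C'$ has $V(C')=V(C)$, tiering map $t'(x_r)=3-t(x_{s+1-r})$, and $x_ix_j\in E(C')$ iff $x_{s+1-i}x_{s+1-j}\in E(C)$; for a general tiered graph $F$, $F'$ is obtained by taking the dual of each component separately. For $F\in\mathcal{F}_{U,p}$, $E_0\cup F$ denotes the graph with vertex set $V(H)$ and edge set $E_0\uplus E(F)$ (edges of $H$ and of $F$ are always distinct edges), regarded as a quasi-tiered graph with designated sets $V_i(E_0\cup F)=V_i(F)$,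 $i=1,2$; two such graphs are different if their edge sets differ or their designated sets $V_1$ differ. $\mathcal{T}_{U,p}(E_0)=\{E_0\cup F: F\in\mathcal{F}_{U,p},\ E_0\cup F\text{ is a tree}\}$. For $T=E_0\cup F\in\mathcal{T}_{U,p}(E_0)$, its dual is $T^*=E_0\cup F'$. -}

module Defs where

open import Data.Nat using (ℕ; zero; suc; _+_; _∸_; _<_; _<ᵇ_; _≡ᵇ_)
open import Data.Bool using (Bool; true; false; _∧_; _∨_; if_then_else_)
open import Data.Fin as Fin using (Fin; zero; suc; toℕ; inject₁; fromℕ)
open import Data.Fin.Subset using (Subset)
open import Data.Vec as Vec using (Vec; tabulate)
open import Data.List as List using (List; []; _∷_; _++_; length; map; concatMap; filterᵇ; allFin)
open import Data.List.Membership.Propositional using (_∈_)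
open import Data.Product using (Σ; _×_; _,_; proj₁; proj₂)
open import Data.Maybe using (Maybe; just; nothing; fromMaybe)
open import Relation.Binary.PropositionalEquality using (_≡_)
open import Relation.Nullary using (¬_)

data Tier : Set where
  one two : Tier

flipT : Tier → Tier
flipT one = two
flipT two = one

-- An edge list L : List Edge; edges are the *positions* of L, so a repeated
-- pair represents parallel edges, and (x , x) is a loop.

Edge : Set
Edge = ℕ × ℕ

data Joins : Edge → ℕ → ℕ → Set where
  fw : ∀ {x y} → Joins (x , y) x y
  bw : ∀ {x y} → Joins (x , y) y x

data Reach (L : List Edge) : ℕ → ℕ → Set where
  here : ∀ {x} → Reach L x x
  step : ∀ {e x y z} → e ∈ L → Joins e x y → Reach L y z → Reach L x z

-- a cycle v₀ e₀ v₁ e₁ … v_k e_k v₀ with distinct vertices and distinct edges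
-- (k = 0: a loop; k = 1: two distinct parallel edges)
record Cycle (L : List Edge) : Set where
  field
    k      : ℕ
    vs     : Fin (suc k) → ℕ
    es     : Fin (suc k) → Fin (length L)
    vs-inj : ∀ i j → vs i ≡ vs j → i ≡ j
    es-inj : ∀ i j → es i ≡ es j → i ≡ j
    joins  : ∀ (i : Fin k) → Joins (List.lookup L (es (inject₁ i))) (vs (inject₁ i)) (vs (suc i))
    closes : Joins (List.lookup L (es (fromℕ k))) (vs (fromℕ k)) (vs zero)

Acyclic : List Edge → Set
Acyclic L = ¬ Cycle L

Connected : List ℕ → List Edge → Set
Connected V L = ∀ x y → x ∈ V → y ∈ V → Reach L x y

IsTree : List ℕ → List Edge → Set
IsTree V L = Connected V L × Acyclic L

record MultiGraph : Set where
  field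
    V       : List ℕ
    m       : ℕ
    ends    : Fin m → Edge
    ends-in : ∀ e → proj₁ (ends e) ∈ V × proj₂ (ends e) ∈ V

open MultiGraph public

edgesOf : (H : MultiGraph) → Subset (m H) → List Edge
edgesOf H E0 = map (ends H) (filterᵇ (λ e → Vec.lookup E0 e) (allFin (m H)))

-- Tiered graphs on U = {u 0 < u 1 < … < u (s-1)}; vertex u i is index i.
-- adjacency matrix and tiering map.

record TGraph (s : ℕ) : Set where
  constructor mkTG
  field
    adj  : Vec (Vec Bool s) s
    tier : Vec Tier s

open TGraph public

adjB : ∀ {s} → TGraph s → Fin s → Fin s → Bool
adjB G i j = Vec.lookup (Vec.lookup (adj G) i) j

Adj : ∀ {s} → TGraph s → Fin s → Fin s → Set
Adj G i j = adjB G i j ≡ true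

tierOf : ∀ {s} → TGraph s → Fin s → Tier
tierOf G i = Vec.lookup (tier G) i

IsSimple : ∀ {s} → TGraph s → Set
IsSimple G = (∀ i j → Adj G i j → Adj G j i) × (∀ i → ¬ Adj G i i)

IsTiered : ∀ {s} → (Fin s → ℕ) → TGraph s → Set
IsTiered u G = ∀ i j → Adj G i j → u j < u i → (tierOf G i ≡ two × tierOf G j ≡ one)

fedges : ∀ {s} → (Fin s → ℕ) → TGraph s → List Edge
fedges {s} u G =
  map (λ ij → u (proj₁ ij) , u (proj₂ ij))
      (filterᵇ (λ ij → (toℕ (proj₁ ij) <ᵇ toℕ (proj₂ ij)) ∧ adjB G (proj₁ ij) (proj₂ ij))
               (concatMap (λ i → map (λ j → i , j) (allFin s)) (allFin s)))

countF : ∀ {s} → (Fin s → Bool) → ℕ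
countF {zero}  f = 0
countF {suc s} f = (if f zero then 1 else 0) + countF (λ i → f (suc i))

anyF : ∀ {s} → (Fin s → Bool) → Bool
anyF {zero}  f = false
anyF {suc s} f = f zero ∨ anyF (λ i → f (suc i))

findF : ∀ {s} → (Fin s → Bool) → Maybe (Fin s)
findF {zero}  f = nothing
findF {suc s} f = if f zero then just zero else Data.Maybe.map suc (findF (λ i → f (suc i)))
  where import Data.Maybe

tierIs : Tier → Tier → Bool
tierIs one one = true
tierIs two two = true
tierIs _   _   = false

countTier : ∀ {s} → TGraph s → Tier → ℕ
countTier G t = countF (λ i → tierIs t (tierOf G i))

InF : ∀ {s} → (Fin s → ℕ) → ℕ → ℕ → TGraph s → Set
InF u p1 p2 F =
  IsSimple F × IsTiered u F × Acyclic (fedges u F)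
  × countTier F one ≡ p1 × countTier F two ≡ p2

-- E₀ ∪ F ∈ 𝓣_{U,p}(E₀)   (E₀ ∪ F is identified with F, as E₀ is fixed)
InT : ∀ {s} → (H : MultiGraph) → Subset (m H) → (Fin s → ℕ) → ℕ → ℕ → TGraph s → Set
InT H E0 u p1 p2 F = InF u p1 p2 F × IsTree (V H) (edgesOf H E0 ++ fedges u F)

reachB : ∀ {s} → TGraph s → ℕ → Fin s → Fin s → Bool
reachB G zero    i j = toℕ i ≡ᵇ toℕ j
reachB G (suc n) i j = reachB G n i j ∨ anyF (λ k → reachB G n i k ∧ adjB G k j)

sameComp : ∀ {s} → TGraph s → Fin s → Fin s → Bool
sameComp {s} G i j = reachB G s i j

compSize : ∀ {s} → TGraph s → Fin s → ℕ
compSize G i = countF (sameComp G i)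

-- 0-based position of i in its component, listed increasingly
compRank : ∀ {s} → TGraph s → Fin s → ℕ
compRank G i = countF (λ j → sameComp G i j ∧ (toℕ j <ᵇ toℕ i))

-- x_r ↦ x_{|C|+1-r} inside the component C of the vertex
mirror : ∀ {s} → TGraph s → Fin s → Fin s
mirror G i = fromMaybe i (findF (λ j → sameComp G i j
                                  ∧ (compRank G j ≡ᵇ (compSize G i ∸ 1 ∸ compRank G i))))

-- the dual F' : x_i x_j ∈ E(C') iff x_{s+1-i} x_{s+1-j} ∈ E(C), t'(x_r) = 3 - t(x_{s+1-r})
dual : ∀ {s} → TGraph s → TGraph s
dual G = mkTG (tabulate (λ i → tabulate (λ j → adjB G (mirror G i) (mirror G j))))
              (tabulate (λ i → flipT (tierOf G (mirror G i))))

-- The mirror map of a simple graph is an involution preserving every component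
-- and reversing the order inside it (module Mirror).  Hence F' is simple and
-- tiered, swaps the tier sizes, has the same components as F, is isomorphic to F
-- (so is a forest), and dual (dual F) ≡ F.  An exchange lemma (module Transfer)
-- shows that replacing the forest part of E₀ ∪ F by a forest with the same
-- components preserves connectivity and acyclicity; acyclicity is handled via
-- bypasses (an edge together with a walk back that avoids it), which are
-- equivalent to the cycles of Defs.

module Submission where

open import Defs
open import Data.Nat using (ℕ; zero; suc; _+_; _∸_; _≤_; _<_; z≤n; s≤s; _<ᵇ_; _≡ᵇ_)
import Data.Nat.Properties as ℕP
open import Data.Bool using (Bool; true; false; _∧_; _∨_; if_then_else_)
open import Data.Bool.Properties using (T-∧; T-≡; ∧-zeroʳ)
open import Data.Fin using (Fin; zero; suc; toℕ; fromℕ; inject₁)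
import Data.Fin as Fin
import Data.Fin.Properties as FinP
open import Data.Fin.Relation.Unary.Top using (view; ‵fromℕ; ‵inj₁)
open import Data.Fin.Permutation using (permutation)
open import Data.Fin.Subset using (Subset)
open import Data.Vec as Vec using (tabulate)
import Data.Vec.Properties as VecP
open import Data.Maybe using (just; fromMaybe)
open import Data.List as List using (List; []; _∷_; _++_; length; map; concatMap; allFin; cartesianProduct)
open import Data.List.Membership.Propositional using (_∈_; _∉_)
open import Data.List.Membership.Propositional.Properties using (∈-lookup; ∈-map⁻; ∈-map⁺; ∈-filter⁻; ∈-filter⁺; ∈-allFin; ∈-cartesianProduct⁺)
open import Data.List.Relation.Unary.Any as Any using (here; there; any?)
open import Data.List.Relation.Unary.Any.Properties using (lookup-index)
open import Data.List.Relation.Unary.All as All using ([]; _∷_)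
open import Data.List.Relation.Unary.All.Properties using (¬Any⇒All¬; All¬⇒¬Any)
open import Data.List.Relation.Unary.Unique.Propositional using (Unique; []; _∷_)
import Data.List.Relation.Unary.Unique.Propositional.Properties as UniqueP
open import Data.Product using (Σ; _×_; _,_; proj₁; proj₂)
open import Data.Sum using (_⊎_; inj₁; inj₂)
open import Data.Empty using (⊥; ⊥-elim)
open import Function.Bundles using (Equivalence)
open import Relation.Nullary using (¬_; yes; no)
open import Relation.Nullary.Decidable using (T?)
open import Relation.Binary.Definitions using (DecidableEquality; tri<; tri≈; tri>)
open import Relation.Binary.PropositionalEquality
import Algebra.Properties.CommutativeMonoid.Sum as CommSum

infixr 5 _∷w_
data Walk {A : Set} (R : A → A → Set) : A → A → Set where
  []w  : ∀ {x} → Walk R x x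
  _∷w_ : ∀ {x y z} → R x y → Walk R y z → Walk R x z

module _ {A : Set} {R : A → A → Set} where

  verts : ∀ {x y} → Walk R x y → List A
  verts {x} []w      = x ∷ []
  verts {x} (_ ∷w w) = x ∷ verts w

  steps : ∀ {x y} → Walk R x y → ℕ
  steps []w      = 0
  steps (_ ∷w w) = suc (steps w)

  infixr 5 _++w_
  _++w_ : ∀ {x y z} → Walk R x y → Walk R y z → Walk R x z
  []w      ++w v = v
  (r ∷w w) ++w v = r ∷w (w ++w v)

  snocw : ∀ {x y z} → Walk R x y → R y z → Walk R x z
  snocw w r = w ++w (r ∷w []w)

  reverseWalk : (∀ {a b} → R a b → R b a) → ∀ {x y} → Walk R x y → Walk R y x
  reverseWalk sym-R []w      = []w
  reverseWalk sym-R (r ∷w w) = snocw (reverseWalk sym-R w) (sym-R r)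

  start∈verts : ∀ {x y} (w : Walk R x y) → x ∈ verts w
  start∈verts []w      = here refl
  start∈verts (_ ∷w _) = here refl

  vertexAt : ∀ {x y} (w : Walk R x y) → Fin (suc (steps w)) → A
  vertexAt {x} w        zero    = x
  vertexAt     (_ ∷w w) (suc i) = vertexAt w i

  vertexAt-last : ∀ {x y} (w : Walk R x y) → vertexAt w (fromℕ (steps w)) ≡ y
  vertexAt-last []w      = refl
  vertexAt-last (_ ∷w w) = vertexAt-last w

  vertexAt-step : ∀ {x y} (w : Walk R x y) (i : Fin (steps w)) →
                  R (vertexAt w (inject₁ i)) (vertexAt w (suc i))
  vertexAt-step (r ∷w w) zero    = r
  vertexAt-step (_ ∷w w) (suc i) = vertexAt-step w i

  vertexAt-∈ : ∀ {x y} (w : Walk R x y) i → vertexAt w i ∈ verts w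
  vertexAt-∈ []w      zero    = here refl
  vertexAt-∈ (_ ∷w w) zero    = here refl
  vertexAt-∈ (_ ∷w w) (suc i) = there (vertexAt-∈ w i)

  vertexAt-injective : ∀ {x y} (w : Walk R x y) → Unique (verts w) →
                       ∀ i j → vertexAt w i ≡ vertexAt w j → i ≡ j
  vertexAt-injective []w      _         zero    zero    _ = refl
  vertexAt-injective (_ ∷w w) _         zero    zero    _ = refl
  vertexAt-injective (_ ∷w w) (x∉ ∷ _)  zero    (suc j) e = ⊥-elim (All.lookup x∉ (vertexAt-∈ w j) e)
  vertexAt-injective (_ ∷w w) (x∉ ∷ _)  (suc i) zero    e = ⊥-elim (All.lookup x∉ (vertexAt-∈ w i) (sym e))
  vertexAt-injective (_ ∷w w) (_ ∷ uw)  (suc i) (suc j) e = cong suc (vertexAt-injective w uw i j e)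

  walkOf : ∀ k (f : Fin (suc k) → A) → (∀ (i : Fin k) → R (f (inject₁ i)) (f (suc i))) →
           Walk R (f zero) (f (fromℕ k))
  walkOf zero    f st = []w
  walkOf (suc k) f st = st zero ∷w walkOf k (λ i → f (suc i)) (λ i → st (suc i))

  module _ (_≟_ : DecidableEquality A) where

    suffixFrom : ∀ {x y z} (p : Walk R y z) → Unique (verts p) → x ∈ verts p →
                 Σ (Walk R x z) (λ q → Unique (verts q))
    suffixFrom []w      up       (here refl) = []w , up
    suffixFrom (r ∷w p) up       (here refl) = (r ∷w p) , up
    suffixFrom (_ ∷w p) (_ ∷ up) (there x∈) = suffixFrom p up x∈

    eraseLoops : ∀ {x y} → Walk R x y → Σ (Walk R x y) (λ q → Unique (verts q))
    eraseLoops []w = []w , ([] ∷ [])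
    eraseLoops {x} (r ∷w w) with eraseLoops w
    ... | p , up with any? (x ≟_) (verts p)
    ... | yes x∈ = suffixFrom p up x∈
    ... | no  x∉ = (r ∷w p) , (¬Any⇒All¬ _ x∉ ∷ up)

mapWalk : ∀ {A B : Set} {R : A → A → Set} {S : B → B → Set} (g : A → B) →
          (∀ {a b} → R a b → S (g a) (g b)) → ∀ {x y} → Walk R x y → Walk S (g x) (g y)
mapWalk g h []w      = []w
mapWalk g h (r ∷w w) = h r ∷w mapWalk g h w

mapSteps : ∀ {A : Set} {R S : A → A → Set} → (∀ {a b} → R a b → S a b) →
           ∀ {x y} → Walk R x y → Walk S x y
mapSteps h []w      = []w
mapSteps h (r ∷w w) = h r ∷w mapSteps h w

bindWalk : ∀ {A : Set} {R S : A → A → Set} → (∀ {a b} → R a b → Walk S a b) →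
           ∀ {x y} → Walk R x y → Walk S x y
bindWalk h []w      = []w
bindWalk h (r ∷w w) = h r ++w bindWalk h w

SamePair : ∀ {A : Set} → A → A → A → A → Set
SamePair a b a' b' = (a ≡ a' × b ≡ b') ⊎ (a ≡ b' × b ≡ a')

samePair-injective : ∀ {A B : Set} (f : A → B) → (∀ {x y} → f x ≡ f y → x ≡ y) →
                     ∀ {a b a' b'} → SamePair (f a) (f b) (f a') (f b') → SamePair a b a' b'
samePair-injective f f-inj (inj₁ (e₁ , e₂)) = inj₁ (f-inj e₁ , f-inj e₂)
samePair-injective f f-inj (inj₂ (e₁ , e₂)) = inj₂ (f-inj e₁ , f-inj e₂)

joins-sym : ∀ {e x y} → Joins e x y → Joins e y x
joins-sym fw = bw
joins-sym bw = fw

joins-same : ∀ {e x y x' y'} → Joins e x y → Joins e x' y' → SamePair x y x' y'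
joins-same fw fw = inj₁ (refl , refl)
joins-same fw bw = inj₂ (refl , refl)
joins-same bw fw = inj₂ (refl , refl)
joins-same bw bw = inj₁ (refl , refl)

-- Edges are positions of the list, so that parallel edges stay apart.
Step : List Edge → ℕ → ℕ → Set
Step L a b = Σ (Fin (length L)) λ q → Joins (List.lookup L q) a b

Avoid : (L : List Edge) → Fin (length L) → ℕ → ℕ → Set
Avoid L c a b = Σ (Fin (length L)) λ q → q ≢ c × Joins (List.lookup L q) a b

avoid-sym : ∀ L c {a b} → Avoid L c a b → Avoid L c b a
avoid-sym L c (q , q≢c , j) = q , q≢c , joins-sym j

forgetAvoid : ∀ L c {a b} → Avoid L c a b → Step L a b
forgetAvoid L c (q , _ , j) = q , j

reach⇒walk : ∀ {L x y} → Reach L x y → Walk (Step L) x y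
reach⇒walk here         = []w
reach⇒walk (step e∈ j r) = (Any.index e∈ , subst (λ E → Joins E _ _) (lookup-index e∈) j) ∷w reach⇒walk r

walk⇒reach : ∀ {L x y} → Walk (Step L) x y → Reach L x y
walk⇒reach []w            = here
walk⇒reach ((q , j) ∷w w) = step (∈-lookup q) j (walk⇒reach w)

avoidUnvisited : ∀ {L c v v'} {R : ℕ → ℕ → Set} → (∀ {a b} → R a b → Step L a b) →
                 Joins (List.lookup L c) v v' → ∀ {x y} (w : Walk R x y) → v ∉ verts w →
                 Walk (Avoid L c) x y
avoidUnvisited toStep jc []w v∉ = []w
avoidUnvisited {L} {c} toStep jc (r ∷w w) v∉ with toStep r
... | q , jq with q Fin.≟ c
... | no q≢c  = (q , q≢c , jq) ∷w avoidUnvisited {L} {c} toStep jc w (λ v∈ → v∉ (there v∈))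
... | yes refl with joins-same jc jq
...   | inj₁ (refl , _) = ⊥-elim (v∉ (here refl))
...   | inj₂ (refl , _) = ⊥-elim (v∉ (there (start∈verts w)))

-- A bypass of the edge c = xy is a walk from y back to x not using c.
-- `NoBypass L` is the walk-based form of acyclicity used throughout.
NoBypass : List Edge → Set
NoBypass L = ∀ c x y → Joins (List.lookup L c) x y → Walk (Avoid L c) y x → ⊥

cycle⇒bypass : ∀ {L} → Cycle L → Σ (Fin (length L)) λ c → Σ ℕ λ x → Σ ℕ λ y →
               Joins (List.lookup L c) x y × Walk (Avoid L c) y x
cycle⇒bypass {L} C = es (fromℕ k) , vs (fromℕ k) , vs zero , closes ,
  walkOf {R = Avoid L (es (fromℕ k))} k vs (λ i → es (inject₁ i) , (λ e → FinP.fromℕ≢inject₁ (sym (es-inj _ _ e))) , joins i)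
  where open Cycle C

extendLast : ∀ {X : Set} k → (Fin k → X) → X → Fin (suc k) → X
extendLast zero    g c zero    = c
extendLast (suc k) g c zero    = g zero
extendLast (suc k) g c (suc i) = extendLast k (λ i → g (suc i)) c i

extendLast-inject₁ : ∀ {X : Set} k (g : Fin k → X) c i → extendLast k g c (inject₁ i) ≡ g i
extendLast-inject₁ (suc k) g c zero    = refl
extendLast-inject₁ (suc k) g c (suc i) = extendLast-inject₁ k (λ i → g (suc i)) c i

extendLast-fromℕ : ∀ {X : Set} k (g : Fin k → X) c → extendLast k g c (fromℕ k) ≡ c
extendLast-fromℕ zero    g c = refl
extendLast-fromℕ (suc k) g c = extendLast-fromℕ k (λ i → g (suc i)) c

-- Conversely, erasing the loops of a bypass and closing it with its edge
-- yields a cycle: vertices are distinct by erasure, and two steps of a path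
-- cannot use the same edge (they would be equal or consecutive in both orders).
bypass⇒cycle : ∀ {L} c x y → Joins (List.lookup L c) x y → Walk (Avoid L c) y x → Cycle L
bypass⇒cycle {L} c x y jc w = record
  { k      = k
  ; vs     = vs
  ; es     = es
  ; vs-inj = vs-inj
  ; es-inj = es-inj
  ; joins  = λ i → subst (λ q → Joins (List.lookup L q) (vs (inject₁ i)) (vs (suc i)))
                         (sym (es-inject₁ i)) (edge-joins i)
  ; closes = subst₂ (λ q z → Joins (List.lookup L q) z y) (sym es-last) (sym (vertexAt-last p)) jc
  }
  where
    path : Σ (Walk (Avoid L c) y x) (λ q → Unique (verts q))
    path = eraseLoops ℕP._≟_ w

    p : Walk (Avoid L c) y x
    p = proj₁ path

    k : ℕ
    k = steps p

    vs : Fin (suc k) → ℕ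
    vs = vertexAt p

    vs-inj : ∀ i j → vs i ≡ vs j → i ≡ j
    vs-inj = vertexAt-injective p (proj₂ path)

    edge : Fin k → Fin (length L)
    edge i = proj₁ (vertexAt-step p i)

    edge≢c : ∀ i → edge i ≢ c
    edge≢c i = proj₁ (proj₂ (vertexAt-step p i))

    edge-joins : ∀ i → Joins (List.lookup L (edge i)) (vs (inject₁ i)) (vs (suc i))
    edge-joins i = proj₂ (proj₂ (vertexAt-step p i))

    es : Fin (suc k) → Fin (length L)
    es = extendLast k edge c

    es-inject₁ : ∀ i → es (inject₁ i) ≡ edge i
    es-inject₁ = extendLast-inject₁ k edge c

    es-last : es (fromℕ k) ≡ c
    es-last = extendLast-fromℕ k edge c

    edge-injective : ∀ i j → edge i ≡ edge j → inject₁ i ≡ inject₁ j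
    edge-injective i j e
      with joins-same (edge-joins i) (subst (λ q → Joins (List.lookup L q) _ _) (sym e) (edge-joins j))
    ... | inj₁ (e₁ , _)  = vs-inj _ _ e₁
    ... | inj₂ (e₁ , e₂) = ⊥-elim (ℕP.m≢1+n+m (toℕ i) {1} i≡i+2)
      where
        i≡i+2 : toℕ i ≡ suc (suc (toℕ i))
        i≡i+2 = begin
          toℕ i                 ≡⟨ sym (FinP.toℕ-inject₁ i) ⟩
          toℕ (inject₁ i)       ≡⟨ cong toℕ (vs-inj _ _ e₁) ⟩
          suc (toℕ j)           ≡⟨ cong suc (sym (FinP.toℕ-inject₁ j)) ⟩
          suc (toℕ (inject₁ j)) ≡⟨ cong (λ f → suc (toℕ f)) (vs-inj _ _ (sym e₂)) ⟩
          suc (suc (toℕ i))     ∎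
          where open ≡-Reasoning

    es-inj : ∀ i j → es i ≡ es j → i ≡ j
    es-inj i j e with view i | view j
    ... | ‵inj₁ {i = i'} _ | ‵inj₁ {i = j'} _ =
      edge-injective i' j' (trans (sym (es-inject₁ i')) (trans e (es-inject₁ j')))
    ... | ‵inj₁ {i = i'} _ | ‵fromℕ = ⊥-elim (edge≢c i' (trans (sym (es-inject₁ i')) (trans e es-last)))
    ... | ‵fromℕ | ‵inj₁ {i = j'} _ = ⊥-elim (edge≢c j' (trans (sym (es-inject₁ j')) (trans (sym e) es-last)))
    ... | ‵fromℕ | ‵fromℕ = refl

acyclic⇒noBypass : ∀ {L} → Acyclic L → NoBypass L
acyclic⇒noBypass ac c x y jc w = ac (bypass⇒cycle c x y jc w)

noBypass⇒acyclic : ∀ {L} → NoBypass L → Acyclic L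
noBypass⇒acyclic nb C with cycle⇒bypass C
... | c , x , y , jc , w = nb c x y jc w

module _ {A : Set} where

  inl : (xs ys : List A) → Fin (length xs) → Fin (length (xs ++ ys))
  inl (_ ∷ xs) ys zero    = zero
  inl (_ ∷ xs) ys (suc q) = suc (inl xs ys q)

  inr : (xs ys : List A) → Fin (length ys) → Fin (length (xs ++ ys))
  inr []       ys q = q
  inr (_ ∷ xs) ys q = suc (inr xs ys q)

  lookup-inl : ∀ (xs ys : List A) q → List.lookup (xs ++ ys) (inl xs ys q) ≡ List.lookup xs q
  lookup-inl (_ ∷ xs) ys zero    = refl
  lookup-inl (_ ∷ xs) ys (suc q) = lookup-inl xs ys q

  lookup-inr : ∀ (xs ys : List A) q → List.lookup (xs ++ ys) (inr xs ys q) ≡ List.lookup ys q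
  lookup-inr []       ys q = refl
  lookup-inr (_ ∷ xs) ys q = lookup-inr xs ys q

  data SplitPos (xs ys : List A) : Fin (length (xs ++ ys)) → Set where
    isl : ∀ q → SplitPos xs ys (inl xs ys q)
    isr : ∀ q → SplitPos xs ys (inr xs ys q)

  splitPos : ∀ (xs ys : List A) q → SplitPos xs ys q
  splitPos []       ys q       = isr q
  splitPos (_ ∷ xs) ys zero    = isl zero
  splitPos (_ ∷ xs) ys (suc q) with splitPos xs ys q
  ... | isl q' = isl (suc q')
  ... | isr q' = isr q'

  inl-injective : ∀ (xs ys : List A) {p q} → inl xs ys p ≡ inl xs ys q → p ≡ q
  inl-injective (_ ∷ xs) ys {zero}  {zero}  e = refl
  inl-injective (_ ∷ xs) ys {suc p} {suc q} e = cong suc (inl-injective xs ys (FinP.suc-injective e))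

  inr-injective : ∀ (xs ys : List A) {p q} → inr xs ys p ≡ inr xs ys q → p ≡ q
  inr-injective []       ys e = e
  inr-injective (_ ∷ xs) ys e = inr-injective xs ys (FinP.suc-injective e)

  inl≢inr : ∀ (xs ys : List A) {p q} → inl xs ys p ≢ inr xs ys q
  inl≢inr (_ ∷ xs) ys {zero}  ()
  inl≢inr (_ ∷ xs) ys {suc p} e = inl≢inr xs ys (FinP.suc-injective e)

  lookup-injective : ∀ {xs : List A} → Unique xs → ∀ i j → List.lookup xs i ≡ List.lookup xs j → i ≡ j
  lookup-injective (_  ∷ _)  zero    zero    e = refl
  lookup-injective (x∉ ∷ _)  zero    (suc j) e = ⊥-elim (All.lookup x∉ (∈-lookup j) e)
  lookup-injective (x∉ ∷ _)  (suc i) zero    e = ⊥-elim (All.lookup x∉ (∈-lookup i) (sym e))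
  lookup-injective (_  ∷ un) (suc i) (suc j) e = cong suc (lookup-injective un i j e)

module _ (xs ys : List Edge) {a b : ℕ} where

  joinsˡ : ∀ {q} → Joins (List.lookup xs q) a b → Joins (List.lookup (xs ++ ys) (inl xs ys q)) a b
  joinsˡ {q} = subst (λ E → Joins E a b) (sym (lookup-inl xs ys q))

  joinsʳ : ∀ {q} → Joins (List.lookup ys q) a b → Joins (List.lookup (xs ++ ys) (inr xs ys q)) a b
  joinsʳ {q} = subst (λ E → Joins E a b) (sym (lookup-inr xs ys q))

  joinsˡ⁻ : ∀ {q} → Joins (List.lookup (xs ++ ys) (inl xs ys q)) a b → Joins (List.lookup xs q) a b
  joinsˡ⁻ {q} = subst (λ E → Joins E a b) (lookup-inl xs ys q)

  joinsʳ⁻ : ∀ {q} → Joins (List.lookup (xs ++ ys) (inr xs ys q)) a b → Joins (List.lookup ys q) a b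
  joinsʳ⁻ {q} = subst (λ E → Joins E a b) (lookup-inr xs ys q)

  stepʳ : Step ys a b → Step (xs ++ ys) a b
  stepʳ (q , j) = inr xs ys q , joinsʳ j

  stepʳ-avoidsˡ : ∀ c → Step ys a b → Avoid (xs ++ ys) (inl xs ys c) a b
  stepʳ-avoidsˡ c (q , j) = inr xs ys q , (λ e → inl≢inr xs ys (sym e)) , joinsʳ j

∧-intro : ∀ {a b} → a ≡ true → b ≡ true → (a ∧ b) ≡ true
∧-intro refl refl = refl

∧-elimˡ : ∀ {a b} → (a ∧ b) ≡ true → a ≡ true
∧-elimˡ {true} _ = refl

∧-elimʳ : ∀ {a b} → (a ∧ b) ≡ true → b ≡ true
∧-elimʳ {true} e = e

∨-introˡ : ∀ {a b} → a ≡ true → (a ∨ b) ≡ true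
∨-introˡ refl = refl

∨-introʳ : ∀ a {b} → b ≡ true → (a ∨ b) ≡ true
∨-introʳ false e = e
∨-introʳ true  _ = refl

∨-elim : ∀ a {b} → (a ∨ b) ≡ true → a ≡ true ⊎ b ≡ true
∨-elim true  _ = inj₁ refl
∨-elim false e = inj₂ e

bool-ext : ∀ {a b : Bool} → (a ≡ true → b ≡ true) → (b ≡ true → a ≡ true) → a ≡ b
bool-ext {false} {false} _ _ = refl
bool-ext {false} {true}  _ g = g refl
bool-ext {true}          f _ = sym (f refl)

<ᵇ-true : ∀ {m n} → m < n → (m <ᵇ n) ≡ true
<ᵇ-true m<n = Equivalence.to T-≡ (ℕP.<⇒<ᵇ m<n)

<ᵇ-sound : ∀ {m n} → (m <ᵇ n) ≡ true → m < n
<ᵇ-sound {m} {n} e = ℕP.<ᵇ⇒< m n (Equivalence.from T-≡ e)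

<ᵇ-irrefl : ∀ m → (m <ᵇ m) ≡ false
<ᵇ-irrefl zero    = refl
<ᵇ-irrefl (suc m) = <ᵇ-irrefl m

≡ᵇ-true : ∀ {m n} → m ≡ n → (m ≡ᵇ n) ≡ true
≡ᵇ-true {m} {n} e = Equivalence.to T-≡ (ℕP.≡⇒≡ᵇ m n e)

≡ᵇ-sound : ∀ {m n} → (m ≡ᵇ n) ≡ true → m ≡ n
≡ᵇ-sound {m} {n} e = ℕP.≡ᵇ⇒≡ m n (Equivalence.from T-≡ e)

indicator : Bool → ℕ
indicator b = if b then 1 else 0

indicator-mono : ∀ {a b} → (a ≡ true → b ≡ true) → indicator a ≤ indicator b
indicator-mono {false}     _ = z≤n
indicator-mono {true}  {b} h rewrite h refl = ℕP.≤-refl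

countF-cong : ∀ {s} {f g : Fin s → Bool} → (∀ i → f i ≡ g i) → countF f ≡ countF g
countF-cong {zero}          h = refl
countF-cong {suc s} {f} {g} h rewrite h zero = cong (_ +_) (countF-cong (λ i → h (suc i)))

countF-mono : ∀ {s} {f g : Fin s → Bool} → (∀ i → f i ≡ true → g i ≡ true) → countF f ≤ countF g
countF-mono {zero}  h = z≤n
countF-mono {suc s} h = ℕP.+-mono-≤ (indicator-mono (h zero)) (countF-mono (λ i → h (suc i)))

countF-strict : ∀ {s} {f g : Fin s → Bool} → (∀ i → f i ≡ true → g i ≡ true) →
                ∀ k → f k ≡ false → g k ≡ true → countF f < countF g
countF-strict {suc s} h zero fk gk rewrite fk | gk = s≤s (countF-mono (λ i → h (suc i)))
countF-strict {suc s} {f} {g} h (suc k) fk gk = begin-strict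
  indicator (f zero) + countF (λ i → f (suc i))
    <⟨ ℕP.+-monoʳ-< (indicator (f zero)) (countF-strict (λ i → h (suc i)) k fk gk) ⟩
  indicator (f zero) + countF (λ i → g (suc i))
    ≤⟨ ℕP.+-monoˡ-≤ (countF (λ i → g (suc i))) (indicator-mono (h zero)) ⟩
  indicator (g zero) + countF (λ i → g (suc i)) ∎
  where open ℕP.≤-Reasoning

countF-false : ∀ {s} (f : Fin s → Bool) → (∀ i → f i ≡ false) → countF f ≡ 0
countF-false {zero}  f h = refl
countF-false {suc s} f h rewrite h zero = countF-false (λ i → f (suc i)) (λ i → h (suc i))

countF-involution : ∀ {s} (f : Fin s → Bool) (σ : Fin s → Fin s) → (∀ i → σ (σ i) ≡ i) →
                    countF (λ i → f (σ i)) ≡ countF f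
countF-involution f σ inv = begin
  countF (λ i → f (σ i))          ≡⟨ countF-sum (λ i → f (σ i)) ⟩
  sum (λ i → indicator (f (σ i))) ≡⟨ sym (sum-permute (λ i → indicator (f i)) (permutation σ σ inv inv)) ⟩
  sum (λ i → indicator (f i))     ≡⟨ sym (countF-sum f) ⟩
  countF f                        ∎
  where
    open ≡-Reasoning
    open CommSum ℕP.+-0-commutativeMonoid using (sum; sum-permute)
    countF-sum : ∀ {s} (f : Fin s → Bool) → countF f ≡ sum (λ i → indicator (f i))
    countF-sum {zero}  f = refl
    countF-sum {suc s} f = cong (indicator (f zero) +_) (countF-sum (λ i → f (suc i)))

rankIn : ∀ {s} → (Fin s → Bool) → Fin s → ℕ
rankIn P i = countF (λ j → P j ∧ (toℕ j <ᵇ toℕ i))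

private
  not-below-self : ∀ {s} (P : Fin s → Bool) i → (P i ∧ (toℕ i <ᵇ toℕ i)) ≡ false
  not-below-self P i = trans (cong (P i ∧_) (<ᵇ-irrefl (toℕ i))) (∧-zeroʳ (P i))

rank<count : ∀ {s} (P : Fin s → Bool) i → P i ≡ true → rankIn P i < countF P
rank<count P i Pi = countF-strict (λ j → ∧-elimˡ) i (not-below-self P i) Pi

rank-strictMono : ∀ {s} (P : Fin s → Bool) a b → P a ≡ true → toℕ a < toℕ b → rankIn P a < rankIn P b
rank-strictMono P a b Pa a<b = countF-strict
  (λ j e → ∧-intro (∧-elimˡ e) (<ᵇ-true (ℕP.<-trans (<ᵇ-sound (∧-elimʳ {P j} e)) a<b))) a
  (not-below-self P a) (∧-intro Pa (<ᵇ-true a<b))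

rank-injective : ∀ {s} (P : Fin s → Bool) a b → P a ≡ true → P b ≡ true → rankIn P a ≡ rankIn P b → a ≡ b
rank-injective P a b Pa Pb r with ℕP.<-cmp (toℕ a) (toℕ b)
... | tri< a<b _ _ = ⊥-elim (ℕP.<-irrefl r (rank-strictMono P a b Pa a<b))
... | tri≈ _ a≡b _ = FinP.toℕ-injective a≡b
... | tri> _ _ b<a = ⊥-elim (ℕP.<-irrefl (sym r) (rank-strictMono P b a Pb b<a))

rank-reflects-< : ∀ {s} (P : Fin s → Bool) a b → P b ≡ true → rankIn P a < rankIn P b → toℕ a < toℕ b
rank-reflects-< P a b Pb r with ℕP.<-cmp (toℕ a) (toℕ b)
... | tri< a<b _ _ = a<b
... | tri≈ _ a≡b _ rewrite FinP.toℕ-injective a≡b = ⊥-elim (ℕP.<-irrefl refl r)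
... | tri> _ _ b<a = ⊥-elim (ℕP.<-asym r (rank-strictMono P b a Pb b<a))

rank-surjective : ∀ {s} (P : Fin s → Bool) r → r < countF P → Σ (Fin s) λ i → P i ≡ true × rankIn P i ≡ r
rank-surjective {suc s} P r r<|P| = go (P zero) refl r r<|P|
  where
    P⁺ : Fin s → Bool
    P⁺ j = P (suc j)

    rank-suc : ∀ i → rankIn P (suc i) ≡ indicator (P zero) + rankIn P⁺ i
    rank-suc i with P zero
    ... | true  = refl
    ... | false = refl

    rank-zero : rankIn P zero ≡ 0
    rank-zero = countF-false _ (λ i → ∧-zeroʳ (P i))

    go : (b : Bool) → P zero ≡ b → ∀ r → r < indicator b + countF P⁺ →
         Σ (Fin (suc s)) λ i → P i ≡ true × rankIn P i ≡ r
    go true  P0 zero    _ = zero , P0 , rank-zero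
    go true  P0 (suc r) (s≤s r<) with rank-surjective P⁺ r r<
    ... | i , Pi , rk = suc i , Pi , trans (rank-suc i) (cong₂ _+_ (cong indicator P0) rk)
    go false P0 r       r< with rank-surjective P⁺ r r<
    ... | i , Pi , rk = suc i , Pi , trans (rank-suc i) (cong₂ _+_ (cong indicator P0) rk)

anyF-sound : ∀ {s} (f : Fin s → Bool) → anyF f ≡ true → Σ (Fin s) λ i → f i ≡ true
anyF-sound {suc s} f e with f zero in f0
... | true  = zero , f0
... | false with anyF-sound (λ i → f (suc i)) e
...   | i , fi = suc i , fi

anyF-complete : ∀ {s} (f : Fin s → Bool) i → f i ≡ true → anyF f ≡ true
anyF-complete f zero    fi rewrite fi = refl
anyF-complete f (suc i) fi = ∨-introʳ (f zero) (anyF-complete (λ i → f (suc i)) i fi)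

findF-unique : ∀ {s} (f : Fin s → Bool) k → f k ≡ true → (∀ j → f j ≡ true → j ≡ k) → findF f ≡ just k
findF-unique f zero fk _ rewrite fk = refl
findF-unique f (suc k) fk uniq with f zero in f0
... | true with uniq zero f0
...   | ()
findF-unique f (suc k) fk uniq | false
  rewrite findF-unique (λ i → f (suc i)) k fk (λ j fj → FinP.suc-injective (uniq (suc j) fj)) = refl

findF-cong : ∀ {s} {f g : Fin s → Bool} → (∀ i → f i ≡ g i) → findF f ≡ findF g
findF-cong {zero}          h = refl
findF-cong {suc s} {f} {g} h
  rewrite h zero | findF-cong {s} {λ i → f (suc i)} {λ i → g (suc i)} (λ i → h (suc i)) = refl

module Components {s : ℕ} (G : TGraph s) where

  reach-refl : ∀ n i → reachB G n i i ≡ true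
  reach-refl zero    i = ≡ᵇ-true {toℕ i} refl
  reach-refl (suc n) i = ∨-introˡ (reach-refl n i)

  reach-zero : ∀ {i j} → reachB G 0 i j ≡ true → i ≡ j
  reach-zero e = FinP.toℕ-injective (≡ᵇ-sound e)

  reach-weaken : ∀ {m n} → m ≤ n → ∀ {i j} → reachB G m i j ≡ true → reachB G n i j ≡ true
  reach-weaken {n = zero}  z≤n e = e
  reach-weaken {n = suc n} m≤1+n e with ℕP.m≤n⇒m<n∨m≡n m≤1+n
  ... | inj₁ (s≤s m≤n) = ∨-introˡ (reach-weaken m≤n e)
  ... | inj₂ refl      = e

  reach-snoc : ∀ n i k j → reachB G n i k ≡ true → Adj G k j → reachB G (suc n) i j ≡ true
  reach-snoc n i k j e a = ∨-introʳ (reachB G n i j) (anyF-complete _ k (∧-intro e a))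

  reach-cons : ∀ n i k j → Adj G i k → reachB G n k j ≡ true → reachB G (suc n) i j ≡ true
  reach-cons zero i k j a e with reach-zero {k} {j} e
  ... | refl = reach-snoc 0 i i k (reach-refl 0 i) a
  reach-cons (suc n) i k j a e with ∨-elim (reachB G n k j) e
  ... | inj₁ e' = ∨-introˡ (reach-cons n i k j a e')
  ... | inj₂ e' with anyF-sound (λ l → reachB G n k l ∧ adjB G l j) e'
  ...   | l , el = reach-snoc (suc n) i l j (reach-cons n i k l a (∧-elimˡ el)) (∧-elimʳ {reachB G n k l} el)

  reach⇒adjWalk : ∀ n i j → reachB G n i j ≡ true → Walk (Adj G) i j
  reach⇒adjWalk zero i j e with reach-zero {i} {j} e
  ... | refl = []w
  reach⇒adjWalk (suc n) i j e with ∨-elim (reachB G n i j) e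
  ... | inj₁ e' = reach⇒adjWalk n i j e'
  ... | inj₂ e' with anyF-sound (λ l → reachB G n i l ∧ adjB G l j) e'
  ...   | l , el = snocw (reach⇒adjWalk n i l (∧-elimˡ el)) (∧-elimʳ {reachB G n i l} el)

  adjWalk⇒reach : ∀ {i j} (w : Walk (Adj G) i j) → reachB G (steps w) i j ≡ true
  adjWalk⇒reach {i} []w = reach-refl 0 i
  adjWalk⇒reach {i} {j} (_∷w_ {y = k} a w) = reach-cons (steps w) i k j a (adjWalk⇒reach w)

  -- a path in G has at most s - 1 steps, so s rounds of reachB suffice
  walk⇒same : ∀ {i j} → Walk (Adj G) i j → sameComp G i j ≡ true
  walk⇒same w with eraseLoops FinP._≟_ w
  ... | p , up = reach-weaken (ℕP.<⇒≤ (FinP.injective⇒≤ (λ {x} {y} → vertexAt-injective p up x y)))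
                              (adjWalk⇒reach p)

  same⇒walk : ∀ {i j} → sameComp G i j ≡ true → Walk (Adj G) i j
  same⇒walk {i} {j} = reach⇒adjWalk s i j

  same-refl : ∀ i → sameComp G i i ≡ true
  same-refl = reach-refl s

  same-trans : ∀ {i j k} → sameComp G i j ≡ true → sameComp G j k ≡ true → sameComp G i k ≡ true
  same-trans e e' = walk⇒same (same⇒walk e ++w same⇒walk e')

  edge⇒same : ∀ {i j} → Adj G i j → sameComp G i j ≡ true
  edge⇒same a = walk⇒same (a ∷w []w)

  module Symmetric (symG : ∀ i j → Adj G i j → Adj G j i) where

    same-sym : ∀ {i j} → sameComp G i j ≡ true → sameComp G j i ≡ true
    same-sym e = walk⇒same (reverseWalk (λ {x} {y} → symG x y) (same⇒walk e))

    same-class : ∀ {i j} → sameComp G i j ≡ true → ∀ k → sameComp G i k ≡ sameComp G j k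
    same-class e k = bool-ext (same-trans (same-sym e)) (same-trans e)

reflect< : ∀ {r S} → r < S → S ∸ 1 ∸ r < S
reflect< {r} {suc S} _ = s≤s (ℕP.m∸n≤m S r)

reflect-involutive : ∀ {r S} → r < S → S ∸ 1 ∸ (S ∸ 1 ∸ r) ≡ r
reflect-involutive {r} {suc S} (s≤s r≤S) = ℕP.m∸[m∸n]≡n r≤S

reflect-reverses : ∀ {r r' S} → r < r' → r' < S → S ∸ 1 ∸ r' < S ∸ 1 ∸ r
reflect-reverses {S = suc S} r<r' (s≤s r'≤S) = ℕP.∸-monoʳ-< r<r' r'≤S

adj-dual : ∀ {s} (G : TGraph s) i j → adjB (dual G) i j ≡ adjB G (mirror G i) (mirror G j)
adj-dual {s} G i j = begin
  Vec.lookup (Vec.lookup (tabulate row) i) j ≡⟨ cong (λ v → Vec.lookup v j) (VecP.lookup∘tabulate row i) ⟩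
  Vec.lookup (row i) j                        ≡⟨ VecP.lookup∘tabulate (λ j → adjB G (mirror G i) (mirror G j)) j ⟩
  adjB G (mirror G i) (mirror G j)            ∎
  where
    open ≡-Reasoning
    row : Fin s → Vec.Vec Bool s
    row i = tabulate (λ j → adjB G (mirror G i) (mirror G j))

tier-dual : ∀ {s} (G : TGraph s) i → tierOf (dual G) i ≡ flipT (tierOf G (mirror G i))
tier-dual G = VecP.lookup∘tabulate (λ i → flipT (tierOf G (mirror G i)))

module Mirror {s : ℕ} (G : TGraph s) (symG : ∀ i j → Adj G i j → Adj G j i) where
  open Components G
  open Symmetric symG

  private
    mi : Fin s → Fin s
    mi = mirror G

    C : Fin s → Fin s → Bool
    C = sameComp G

  -- the rank that mirror G i has in the component of i
  target : Fin s → ℕ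
  target i = compSize G i ∸ 1 ∸ compRank G i

  rank-class : ∀ {i j} → C i j ≡ true → ∀ k → rankIn (C i) k ≡ rankIn (C j) k
  rank-class e k = countF-cong (λ l → cong (_∧ _) (same-class e l))

  size-class : ∀ {i j} → C i j ≡ true → compSize G i ≡ compSize G j
  size-class e = countF-cong (same-class e)

  rank<size : ∀ i → compRank G i < compSize G i
  rank<size i = rank<count (C i) i (same-refl i)

  mirror-char : ∀ i m → C i m ≡ true → rankIn (C i) m ≡ target i → mi i ≡ m
  mirror-char i m e r = cong (fromMaybe i) (findF-unique _ m
    (∧-intro e (≡ᵇ-true (trans (sym (rank-class e m)) r)))
    (λ j fj → rank-injective (C i) j m (∧-elimˡ fj) e
      (trans (rank-class (∧-elimˡ fj) j) (trans (≡ᵇ-sound (∧-elimʳ {C i j} fj)) (sym r)))))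

  mirror-spec : ∀ i → C i (mi i) ≡ true × rankIn (C i) (mi i) ≡ target i
  mirror-spec i with rank-surjective (C i) (target i) (reflect< (rank<size i))
  ... | m , e , r rewrite mirror-char i m e r = e , r

  mirror-same : ∀ i → C i (mi i) ≡ true
  mirror-same i = proj₁ (mirror-spec i)

  mirror-involutive : ∀ i → mi (mi i) ≡ i
  mirror-involutive i = mirror-char (mi i) i (same-sym e) (begin
    rankIn (C (mi i)) i                  ≡⟨ sym (rank-class e i) ⟩
    compRank G i                         ≡⟨ sym (reflect-involutive (rank<size i)) ⟩
    S ∸ 1 ∸ (S ∸ 1 ∸ compRank G i)       ≡⟨ cong (λ x → S ∸ 1 ∸ x) (sym r) ⟩
    S ∸ 1 ∸ rankIn (C i) (mi i)          ≡⟨ cong (λ x → S ∸ 1 ∸ x) (rank-class e (mi i)) ⟩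
    S ∸ 1 ∸ compRank G (mi i)            ≡⟨ cong (λ x → x ∸ 1 ∸ compRank G (mi i)) (size-class e) ⟩
    target (mi i)                        ∎)
    where
      open ≡-Reasoning
      S : ℕ
      S = compSize G i
      e : C i (mi i) ≡ true
      e = mirror-same i
      r : rankIn (C i) (mi i) ≡ target i
      r = proj₂ (mirror-spec i)

  mirror-injective : ∀ {i j} → mi i ≡ mi j → i ≡ j
  mirror-injective {i} {j} e = trans (sym (mirror-involutive i)) (trans (cong mi e) (mirror-involutive j))

  mirror-reverses : ∀ i j → C i j ≡ true → toℕ j < toℕ i → toℕ (mi i) < toℕ (mi j)
  mirror-reverses i j e j<i = rank-reflects-< (C i) (mi i) (mi j) (same-trans e (mirror-same j))
    (subst₂ _<_ (sym (proj₂ (mirror-spec i))) (sym rank-mi-j)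
      (reflect-reverses (rank-strictMono (C i) j i e j<i) (rank<size i)))
    where
      open ≡-Reasoning
      rank-mi-j : rankIn (C i) (mi j) ≡ compSize G i ∸ 1 ∸ rankIn (C i) j
      rank-mi-j = begin
        rankIn (C i) (mi j)               ≡⟨ rank-class e (mi j) ⟩
        rankIn (C j) (mi j)               ≡⟨ proj₂ (mirror-spec j) ⟩
        target j                          ≡⟨ cong₂ (λ a b → a ∸ 1 ∸ b) (sym (size-class e)) (sym (rank-class e j)) ⟩
        compSize G i ∸ 1 ∸ rankIn (C i) j ∎

  dual-adj : ∀ {a b} → Adj (dual G) a b → Adj G (mi a) (mi b)
  dual-adj {a} {b} x = trans (sym (adj-dual G a b)) x

  adj⇒dual : ∀ {a b} → Adj G a b → Adj (dual G) (mi a) (mi b)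
  adj⇒dual {a} {b} x = trans (adj-dual G (mi a) (mi b))
    (subst₂ (λ p q → adjB G p q ≡ true) (sym (mirror-involutive a)) (sym (mirror-involutive b)) x)

  dual-symmetric : ∀ i j → Adj (dual G) i j → Adj (dual G) j i
  dual-symmetric i j x = trans (adj-dual G j i) (symG _ _ (dual-adj x))

  -- an edge ab of the dual joins a ~ mi a to mi b ~ b
  dualEdge⇒same : ∀ {a b} → Adj (dual G) a b → C a b ≡ true
  dualEdge⇒same {a} {b} x =
    same-trans (mirror-same a) (same-trans (edge⇒same (dual-adj x)) (same-sym (mirror-same b)))

  dualWalk⇒same : ∀ {a b} → Walk (Adj (dual G)) a b → C a b ≡ true
  dualWalk⇒same {a} []w      = same-refl a
  dualWalk⇒same     (x ∷w w) = same-trans (dualEdge⇒same x) (dualWalk⇒same w)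

  -- a G-walk from mi a to mi b, mirrored, is a walk of the dual from a to b
  same⇒dualWalk : ∀ {a b} → C a b ≡ true → Walk (Adj (dual G)) a b
  same⇒dualWalk {a} {b} e = subst₂ (Walk (Adj (dual G))) (mirror-involutive a) (mirror-involutive b)
    (mapWalk mi adj⇒dual (same⇒walk (same-trans (same-sym (mirror-same a)) (same-trans e (mirror-same b)))))

  same-dual : ∀ i j → sameComp (dual G) i j ≡ C i j
  same-dual i j = bool-ext (λ x → dualWalk⇒same (Components.same⇒walk (dual G) x))
                           (λ x → Components.walk⇒same (dual G) (same⇒dualWalk x))

  -- the dual has the same components, hence the same mirror map
  mirror-dual : ∀ i → mirror (dual G) i ≡ mi i
  mirror-dual i = cong (fromMaybe i) (findF-cong (λ j → cong₂ _∧_ (same-dual i j)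
    (cong₂ _≡ᵇ_ (countF-cong (λ l → cong (_∧ _) (same-dual j l)))
                (cong₂ _∸_ (cong (_∸ 1) (countF-cong (same-dual i)))
                           (countF-cong (λ l → cong (_∧ _) (same-dual i l)))))))

  flipT-involutive : ∀ t → flipT (flipT t) ≡ t
  flipT-involutive one = refl
  flipT-involutive two = refl

  dual-involutive : dual (dual G) ≡ G
  dual-involutive = cong₂ mkTG
    (trans (VecP.tabulate-cong (λ i → VecP.tabulate-cong (λ j → begin
              adjB (dual G) (mirror (dual G) i) (mirror (dual G) j) ≡⟨ cong₂ (adjB (dual G)) (mirror-dual i) (mirror-dual j) ⟩
              adjB (dual G) (mi i) (mi j)                           ≡⟨ adj-dual G (mi i) (mi j) ⟩
              adjB G (mi (mi i)) (mi (mi j))                        ≡⟨ cong₂ (adjB G) (mirror-involutive i) (mirror-involutive j) ⟩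
              adjB G i j                                            ∎)))
      (trans (VecP.tabulate-cong (λ i → VecP.tabulate∘lookup (Vec.lookup (adj G) i)))
             (VecP.tabulate∘lookup (adj G))))
    (trans (VecP.tabulate-cong (λ i → begin
              flipT (tierOf (dual G) (mirror (dual G) i)) ≡⟨ cong (λ x → flipT (tierOf (dual G) x)) (mirror-dual i) ⟩
              flipT (tierOf (dual G) (mi i))              ≡⟨ cong flipT (tier-dual G (mi i)) ⟩
              flipT (flipT (tierOf G (mi (mi i))))        ≡⟨ flipT-involutive _ ⟩
              tierOf G (mi (mi i))                        ≡⟨ cong (tierOf G) (mirror-involutive i) ⟩
              tierOf G i                                  ∎))
      (VecP.tabulate∘lookup (tier G)))
    where open ≡-Reasoning

sortedEdge-unique : ∀ {e e' : Edge} {x y} → proj₁ e < proj₂ e → proj₁ e' < proj₂ e' →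
                    Joins e x y → Joins e' x y → e ≡ e'
sortedEdge-unique _  _   fw fw = refl
sortedEdge-unique lt lt' fw bw = ⊥-elim (ℕP.<-asym lt lt')
sortedEdge-unique lt lt' bw fw = ⊥-elim (ℕP.<-asym lt lt')
sortedEdge-unique _  _   bw bw = refl

module EdgeList {s : ℕ} (u : Fin s → ℕ) (u-mono : ∀ i j → i Fin.< j → u i < u j) (K : TGraph s)
                (symK : ∀ i j → Adj K i j → Adj K j i) (loopK : ∀ i → ¬ Adj K i i) where

  M : List Edge
  M = fedges u K

  u-injective : ∀ {i j} → u i ≡ u j → i ≡ j
  u-injective {i} {j} e with ℕP.<-cmp (toℕ i) (toℕ j)
  ... | tri< i<j _ _ = ⊥-elim (ℕP.<-irrefl e (u-mono i j i<j))
  ... | tri≈ _ i≡j _ = FinP.toℕ-injective i≡j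
  ... | tri> _ _ j<i = ⊥-elim (ℕP.<-irrefl (sym e) (u-mono j i j<i))

  private
    pairs : List (Fin s × Fin s)
    pairs = concatMap (λ i → map (λ j → i , j) (allFin s)) (allFin s)

    pairs≡ : ∀ (xs : List (Fin s)) → concatMap (λ i → map (λ j → i , j) (allFin s)) xs ≡ cartesianProduct xs (allFin s)
    pairs≡ []       = refl
    pairs≡ (x ∷ xs) = cong (map (λ j → x , j) (allFin s) ++_) (pairs≡ xs)

    ∈pairs : ∀ i j → (i , j) ∈ pairs
    ∈pairs i j = subst ((i , j) ∈_) (sym (pairs≡ (allFin s))) (∈-cartesianProduct⁺ (∈-allFin i) (∈-allFin j))

    kept : Fin s × Fin s → Bool
    kept (i , j) = (toℕ i <ᵇ toℕ j) ∧ adjB K i j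

    pairEdge : Fin s × Fin s → Edge
    pairEdge (i , j) = u i , u j

  entry⇒adj : ∀ q → Σ (Fin s) λ i → Σ (Fin s) λ j →
              toℕ i < toℕ j × Adj K i j × List.lookup M q ≡ (u i , u j)
  entry⇒adj q with ∈-map⁻ pairEdge (∈-lookup {xs = M} q)
  ... | (i , j) , ij∈ , e with Equivalence.to T-∧ (proj₂ (∈-filter⁻ (λ x → T? (kept x)) {xs = pairs} ij∈))
  ... | i<j , adj = i , j , ℕP.<ᵇ⇒< _ _ i<j , Equivalence.to T-≡ adj , e

  adj⇒entry : ∀ i j → toℕ i < toℕ j → Adj K i j → Σ (Fin (length M)) λ q → List.lookup M q ≡ (u i , u j)
  adj⇒entry i j i<j a = Any.index u∈ , sym (lookup-index u∈)
    where
      u∈ : (u i , u j) ∈ M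
      u∈ = ∈-map⁺ pairEdge (∈-filter⁺ (λ x → T? (kept x)) (∈pairs i j)
                          (Equivalence.from T-∧ (ℕP.<⇒<ᵇ i<j , Equivalence.from T-≡ a)))

  M-unique : Unique M
  M-unique = UniqueP.map⁺ pairEdge-injective (UniqueP.filter⁺ (λ x → T? (kept x))
    (subst Unique (sym (pairs≡ (allFin s))) (UniqueP.cartesianProduct⁺ (UniqueP.allFin⁺ s) (UniqueP.allFin⁺ s))))
    where
      pairEdge-injective : ∀ {x y} → pairEdge x ≡ pairEdge y → x ≡ y
      pairEdge-injective {_ , _} {_ , _} e = cong₂ _,_ (u-injective (cong proj₁ e)) (u-injective (cong proj₂ e))

  adj⇒step : ∀ {a b} → Adj K a b → Step M (u a) (u b)
  adj⇒step {a} {b} x with ℕP.<-cmp (toℕ a) (toℕ b)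
  ... | tri< a<b _ _ with adj⇒entry a b a<b x
  ...   | q , e = q , subst (λ E → Joins E (u a) (u b)) (sym e) fw
  adj⇒step {a} {b} x | tri≈ _ a≡b _ with FinP.toℕ-injective a≡b
  ...   | refl = ⊥-elim (loopK a x)
  adj⇒step {a} {b} x | tri> _ _ b<a with adj⇒entry b a b<a (symK a b x)
  ...   | q , e = q , subst (λ E → Joins E (u a) (u b)) (sym e) bw

  step⇒adj : ∀ {x y} → Step M x y → Σ (Fin s) λ a → Σ (Fin s) λ b → x ≡ u a × y ≡ u b × Adj K a b
  step⇒adj {x} {y} (q , jq) with entry⇒adj q
  ... | i , j , _ , a , e with subst (λ E → Joins E x y) e jq
  ...   | fw = i , j , refl , refl , a
  ...   | bw = j , i , refl , refl , symK i j a

  step⇒adjᵤ : ∀ {a b} → Step M (u a) (u b) → Adj K a b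
  step⇒adjᵤ st with step⇒adj st
  ... | _ , _ , ea , eb , a rewrite u-injective ea | u-injective eb = a

  adjWalk⇒stepWalk : ∀ {a b} → Walk (Adj K) a b → Walk (Step M) (u a) (u b)
  adjWalk⇒stepWalk = mapWalk u adj⇒step

  liftWalk : ∀ {R : ℕ → ℕ → Set} → (∀ {x y} → R x y → Step M x y) →
             ∀ {x y a b} → Walk R x y → x ≡ u a → y ≡ u b → Walk (λ a b → R (u a) (u b)) a b
  liftWalk toStep {a = a} []w refl e = subst (Walk _ a) (u-injective e) []w
  liftWalk toStep (r ∷w w) refl e with step⇒adj (toStep r)
  ... | a' , b' , ea , refl , _ with u-injective ea
  ...   | refl = r ∷w liftWalk toStep w refl e

  position-unique : ∀ {q q' x y} → Joins (List.lookup M q) x y → Joins (List.lookup M q') x y → q ≡ q'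
  position-unique {q} {q'} jq jq' =
    lookup-injective M-unique q q' (sortedEdge-unique (sorted q) (sorted q') jq jq')
    where
      sorted : ∀ q → proj₁ (List.lookup M q) < proj₂ (List.lookup M q)
      sorted q with entry⇒adj q
      ... | i , j , i<j , _ , e rewrite e = u-mono i j i<j

module Transfer {s : ℕ} (u : Fin s → ℕ) (u-mono : ∀ i j → i Fin.< j → u i < u j) (L₀ : List Edge)
                (K₁ K₂ : TGraph s)
                (sym₁ : ∀ i j → Adj K₁ i j → Adj K₁ j i) (loop₁ : ∀ i → ¬ Adj K₁ i i)
                (sym₂ : ∀ i j → Adj K₂ i j → Adj K₂ j i) (loop₂ : ∀ i → ¬ Adj K₂ i i)
                (K₂⊆K₁ : ∀ {i j} → Adj K₂ i j → Walk (Adj K₁) i j) where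

  module E₁ = EdgeList u u-mono K₁ sym₁ loop₁
  module E₂ = EdgeList u u-mono K₂ sym₂ loop₂

  L₁ L₂ : List Edge
  L₁ = L₀ ++ E₁.M
  L₂ = L₀ ++ E₂.M

  step₂⇒walk₁ : ∀ {x y} → Step E₂.M x y → Walk (Step E₁.M) x y
  step₂⇒walk₁ st with E₂.step⇒adj st
  ... | _ , _ , refl , refl , a = E₁.adjWalk⇒stepWalk (K₂⊆K₁ a)

  convert : ∀ {x y} → Step L₂ x y → Walk (Step L₁) x y
  convert (q , jq) with splitPos L₀ E₂.M q
  ... | isl q₀ = (inl L₀ E₁.M q₀ , joinsˡ L₀ E₁.M (joinsˡ⁻ L₀ E₂.M jq)) ∷w []w
  ... | isr q₂ = mapSteps (stepʳ L₀ E₁.M) (step₂⇒walk₁ (q₂ , joinsʳ⁻ L₀ E₂.M jq))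

  convertAvoiding : ∀ c₀ {x y} → Avoid L₂ (inl L₀ E₂.M c₀) x y → Walk (Avoid L₁ (inl L₀ E₁.M c₀)) x y
  convertAvoiding c₀ (q , q≢c , jq) with splitPos L₀ E₂.M q
  ... | isl q₀ = (inl L₀ E₁.M q₀ , (λ e → q≢c (cong (inl L₀ E₂.M) (inl-injective L₀ E₁.M e)))
                 , joinsˡ L₀ E₁.M (joinsˡ⁻ L₀ E₂.M jq)) ∷w []w
  ... | isr q₂ = mapSteps (stepʳ-avoidsˡ L₀ E₁.M c₀) (step₂⇒walk₁ (q₂ , joinsʳ⁻ L₀ E₂.M jq))

  connected : ∀ V → Connected V L₂ → Connected V L₁
  connected V conn x y x∈ y∈ = walk⇒reach (bindWalk convert (reach⇒walk (conn x y x∈ y∈)))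

  module _ (nb₁ : NoBypass L₁) (nb₂ : NoBypass E₂.M) where

    -- Let c = ij be an edge of M₂ and follow a path P from j back towards i that
    -- avoids c, remembering the walk `pre` from i travelled so far along M₂.
    -- If P reaches i using only M₂, then pre is a bypass of c in M₂.  Otherwise
    -- P first leaves the current vertex v along an edge e = vw of L₀; the rest
    -- of P (which never revisits v) followed by cᵀ and pre back to v is a bypass
    -- of e in L₀ ++ M₂ avoiding e, which `convertAvoiding` turns into one in L₁.
    scan : ∀ {c i j} → Joins (List.lookup E₂.M c) i j → ∀ {v} → Walk (Avoid E₂.M c) i v →
           (P : Walk (Avoid L₂ (inr L₀ E₂.M c)) v j) → Unique (verts P) → ⊥
    scan {c} {i} {j} jc pre []w _ = nb₂ c j i (joins-sym jc) pre
    scan {c} {i} {j} jc {v} pre (_∷w_ {y = w} (q , q≢c , jq) P) (v∉P ∷ up) with splitPos L₀ E₂.M q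
    ... | isr q₂ = scan jc (snocw pre (q₂ , (λ e → q≢c (cong (inr L₀ E₂.M) e)) , joinsʳ⁻ L₀ E₂.M jq)) P up
    ... | isl q₀ = nb₁ (inl L₀ E₁.M q₀) v w (joinsˡ L₀ E₁.M (joinsˡ⁻ L₀ E₂.M jq)) (rest ++w back)
      where
        rest : Walk (Avoid L₁ (inl L₀ E₁.M q₀)) w j
        rest = bindWalk (convertAvoiding q₀)
                 (avoidUnvisited {L₂} {inl L₀ E₂.M q₀} (forgetAvoid L₂ (inr L₀ E₂.M c)) jq P (All¬⇒¬Any v∉P))
        back : Walk (Avoid L₁ (inl L₀ E₁.M q₀)) j v
        back = mapSteps (stepʳ-avoidsˡ L₀ E₁.M q₀)
                 (bindWalk step₂⇒walk₁ ((c , joins-sym jc) ∷w mapSteps (forgetAvoid E₂.M c) pre))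

    noBypass : NoBypass L₂
    noBypass c x y jc W with splitPos L₀ E₂.M c
    ... | isl c₀ = nb₁ (inl L₀ E₁.M c₀) x y (joinsˡ L₀ E₁.M (joinsˡ⁻ L₀ E₂.M jc)) (bindWalk (convertAvoiding c₀) W)
    ... | isr c₂ with eraseLoops ℕP._≟_ (reverseWalk (avoid-sym L₂ (inr L₀ E₂.M c₂)) W)
    ...   | P , up = scan (joinsʳ⁻ L₀ E₂.M jc) []w P up

module Relabel {s : ℕ} (u : Fin s → ℕ) (u-mono : ∀ i j → i Fin.< j → u i < u j) (K₁ K₂ : TGraph s)
               (sym₁ : ∀ i j → Adj K₁ i j → Adj K₁ j i) (loop₁ : ∀ i → ¬ Adj K₁ i i)
               (sym₂ : ∀ i j → Adj K₂ i j → Adj K₂ j i) (loop₂ : ∀ i → ¬ Adj K₂ i i)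
               (σ : Fin s → Fin s) (σ-injective : ∀ {i j} → σ i ≡ σ j → i ≡ j)
               (σ-adj : ∀ {a b} → Adj K₂ a b → Adj K₁ (σ a) (σ b)) where

  module E₁ = EdgeList u u-mono K₁ sym₁ loop₁
  module E₂ = EdgeList u u-mono K₂ sym₂ loop₂

  noBypass : NoBypass E₁.M → NoBypass E₂.M
  noBypass nb₁ c x y jc W with E₂.step⇒adj (c , jc)
  ... | i , j , refl , refl , aij with E₁.adj⇒step (σ-adj aij)
  ...   | c' , jc' = nb₁ c' (u (σ i)) (u (σ j)) jc'
                       (mapWalk {S = Avoid E₁.M c'} (λ a → u (σ a)) relabel (E₂.liftWalk (forgetAvoid E₂.M c) W refl refl))
    where
      relabel : ∀ {a b} → Avoid E₂.M c (u a) (u b) → Avoid E₁.M c' (u (σ a)) (u (σ b))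
      relabel {a} {b} (q , q≢c , jq) with E₁.adj⇒step (σ-adj (E₂.step⇒adjᵤ (q , jq)))
      ... | q' , jq' = q' , q'≢c' , jq'
        where
          q'≢c' : q' ≢ c'
          q'≢c' refl with samePair-injective (λ a → u (σ a)) (λ e → σ-injective (E₁.u-injective e))
                            (joins-same jq' jc')
          ... | inj₁ (refl , refl) = q≢c (E₂.position-unique jq jc)
          ... | inj₂ (refl , refl) = q≢c (E₂.position-unique jq (joins-sym jc))

tierIs-flipT : ∀ t x → tierIs t (flipT x) ≡ tierIs (flipT t) x
tierIs-flipT one one = refl
tierIs-flipT one two = refl
tierIs-flipT two one = refl
tierIs-flipT two two = refl

-- As F' has the components of F and is
-- isomorphic to F via the mirror map, L₀ ∪ F' is connected (resp. acyclic)
-- whenever L₀ ∪ F is, for a forest F.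
module DualOf {s : ℕ} (u : Fin s → ℕ) (u-mono : ∀ i j → i Fin.< j → u i < u j) (L₀ : List Edge)
              (F : TGraph s) (symF : ∀ i j → Adj F i j → Adj F j i) (loopF : ∀ i → ¬ Adj F i i) where
  open Mirror F symF
  open Components F using (edge⇒same; same⇒walk)

  dual-loopless : ∀ i → ¬ Adj (dual F) i i
  dual-loopless i x = loopF (mirror F i) (dual-adj x)

  dual-simple : IsSimple (dual F)
  dual-simple = dual-symmetric , dual-loopless

  countTier-dual : ∀ t → countTier (dual F) t ≡ countTier F (flipT t)
  countTier-dual t = trans
    (countF-cong {f = λ i → tierIs t (tierOf (dual F) i)} {g = λ i → tierIs (flipT t) (tierOf F (mirror F i))}
                 (λ i → trans (cong (tierIs t) (tier-dual F i)) (tierIs-flipT t (tierOf F (mirror F i)))))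
    (countF-involution (λ i → tierIs (flipT t) (tierOf F i)) (mirror F) mirror-involutive)

  -- an edge ij of F' with u j < u i mirrors an edge of F with the opposite order
  dual-tiered : IsTiered u F → IsTiered u (dual F)
  dual-tiered tieredF i j x uj<ui =
    trans (tier-dual F i) (cong flipT (proj₂ tiers)) , trans (tier-dual F j) (cong flipT (proj₁ tiers))
    where
      j<i : toℕ j < toℕ i
      j<i with ℕP.<-cmp (toℕ j) (toℕ i)
      ... | tri< j<i _ _ = j<i
      ... | tri≈ _ j≡i _ = ⊥-elim (ℕP.<-irrefl (cong u (FinP.toℕ-injective j≡i)) uj<ui)
      ... | tri> _ _ i<j = ⊥-elim (ℕP.<-asym uj<ui (u-mono i j i<j))

      tiers : tierOf F (mirror F j) ≡ two × tierOf F (mirror F i) ≡ one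
      tiers = tieredF (mirror F j) (mirror F i) (symF _ _ (dual-adj x))
                      (u-mono _ _ (mirror-reverses i j (dualEdge⇒same x) j<i))

  dual-forest : Acyclic (fedges u F) → Acyclic (fedges u (dual F))
  dual-forest acF = noBypass⇒acyclic
    (Relabel.noBypass u u-mono F (dual F) symF loopF dual-symmetric dual-loopless
                      (mirror F) mirror-injective dual-adj (acyclic⇒noBypass acF))

  dual-connected : ∀ V → Connected V (L₀ ++ fedges u F) → Connected V (L₀ ++ fedges u (dual F))
  dual-connected = Transfer.connected u u-mono L₀ (dual F) F dual-symmetric dual-loopless symF loopF
                     (λ a → same⇒dualWalk (edge⇒same a))

  dual-acyclic : Acyclic (L₀ ++ fedges u F) → Acyclic (fedges u F) → Acyclic (L₀ ++ fedges u (dual F))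
  dual-acyclic ac acF = noBypass⇒acyclic
    (Transfer.noBypass u u-mono L₀ F (dual F) symF loopF dual-symmetric dual-loopless
                       (λ a → same⇒walk (dualEdge⇒same a))
                       (acyclic⇒noBypass ac) (acyclic⇒noBypass (dual-forest acF)))

dual-InT : ∀ {s} (u : Fin s → ℕ) → (∀ i j → i Fin.< j → u i < u j) →
           (H : MultiGraph) (E0 : Subset (m H)) {p1 p2 : ℕ} (F : TGraph s) →
           InT H E0 u p1 p2 F → InT H E0 u p2 p1 (dual F)
dual-InT u u-mono H E0 F (((symF , loopF) , tieredF , forestF , count₁ , count₂) , connected , acyclic) =
  ( Dual.dual-simple
  , Dual.dual-tiered tieredF
  , Dual.dual-forest forestF
  , trans (Dual.countTier-dual one) count₂
  , trans (Dual.countTier-dual two) count₁ )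
  , Dual.dual-connected (V H) connected
  , Dual.dual-acyclic acyclic forestF
  where module Dual = DualOf u u-mono (edgesOf H E0) F symF loopF

dual-dual : ∀ {s} (F : TGraph s) → IsSimple F → dual (dual F) ≡ F
dual-dual F (symF , _) = Mirror.dual-involutive F symF

-- Proposition 2.2.
proposition2p2 :
    (s : ℕ) (u : Fin s → ℕ) → 0 < s → (∀ i → 0 < u i) →
    (∀ i j → i Data.Fin.< j → u i < u j) →
    (p1 p2 : ℕ) → 0 < p1 → 0 < p2 → p1 + p2 ≡ s →
    (H : MultiGraph) → (∀ i → u i ∈ V H) →
    (E0 : Subset (m H)) → Acyclic (edgesOf H E0) →
    ((F : TGraph s) → InT H E0 u p1 p2 F → InT H E0 u p2 p1 (dual F))
    × ((F G : TGraph s) → InT H E0 u p1 p2 F → InT H E0 u p1 p2 G → dual F ≡ dual G → F ≡ G)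
    × ((G : TGraph s) → InT H E0 u p2 p1 G → Σ (TGraph s) (λ F → InT H E0 u p1 p2 F × dual F ≡ G))
proposition2p2 s u _ _ u-mono p1 p2 _ _ _ H _ E0 _ =
  dual-InT u u-mono H E0 , injective , surjective
  where
    simple : ∀ {q1 q2} F → InT H E0 u q1 q2 F → IsSimple F
    simple F inT = proj₁ (proj₁ inT)

    injective : ∀ F G → InT H E0 u p1 p2 F → InT H E0 u p1 p2 G → dual F ≡ dual G → F ≡ G
    injective F G inF inG e = begin
      F               ≡⟨ sym (dual-dual F (simple F inF)) ⟩
      dual (dual F)   ≡⟨ cong dual e ⟩
      dual (dual G)   ≡⟨ dual-dual G (simple G inG) ⟩
      G               ∎
      where open ≡-Reasoning

    surjective : ∀ G → InT H E0 u p2 p1 G → Σ (TGraph s) (λ F → InT H E0 u p1 p2 F × dual F ≡ G)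
    surjective G inG = dual G , dual-InT u u-mono H E0 G inG , dual-dual G (simple G inG)
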